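{- Let $\Gamma$ be a connected graph whose automorphism group acts primitively on $V\Gamma$ and which has infinite diameter. Then for all distinct $\gamma,\delta\in V\Gamma$ and all integers $n\ge1$, $S(\gamma,n)\neq S(\delta,n)$. In particular, $\Gamma$ satisfies the Distinct Spheres Condition.
   Context: Graphs are simple; $d$ is graph distance, $S(\gamma,n)=\{\beta\in V\Gamma:d(\gamma,\beta)=n\}$. Primitive: the automorphism group is transitive on vertices and the only automorphism-invariant equivalence relations on $V\Gamma$ are equality and the universal relation. The diameter is the supremum of distances between vertices. $\Gamma$ satisfies the Distinct Spheres Condition if there exists $\alpha\in V\Gamma$ such that for all distinct $\gamma,\delta$ with $d(\alpha,\gamma)=d(\alpha,\delta)$ we have $S(\gamma,n)\neq S(\delta,n)$ for infinitely many $n\in\mathbb{N}$. -}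

module Defs where

open import Data.Nat using (ℕ; zero; suc; _<_; _≤_)
open import Data.Product using (Σ; ∃; ∃-syntax; _×_; _,_)
open import Data.Sum using (_⊎_)
open import Relation.Nullary using (¬_)
open import Relation.Binary.PropositionalEquality using (_≡_; _≢_)
open import Relation.Binary.Structures using (IsEquivalence)
open import Function.Bundles using (_↔_; Inverse; _⇔_)

record Graph : Set₁ where
  field
    V     : Set
    Adj   : V → V → Set
    sym   : ∀ {x y} → Adj x y → Adj y x
    irref : ∀ {x} → ¬ Adj x x

module _ (Γ : Graph) where
  open Graph Γ

  data Walk : V → V → ℕ → Set where
    here : ∀ {x} → Walk x x zero
    step : ∀ {x y z n} → Adj x y → Walk y z n → Walk x z (suc n)

  Dist : V → V → ℕ → Set
  Dist x y n = Walk x y n × (∀ m → m < n → ¬ Walk x y m)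

  Connected : Set
  Connected = ∀ x y → ∃[ n ] Walk x y n

  Sphere : V → ℕ → V → Set
  Sphere γ n β = Dist γ β n

  SameSphere : V → V → ℕ → Set
  SameSphere γ δ n = ∀ β → (Sphere γ n β ⇔ Sphere δ n β)

  record Aut : Set where
    field
      perm : V ↔ V
      pres : ∀ x y → Adj x y ⇔ Adj (Inverse.to perm x) (Inverse.to perm y)

  app : Aut → V → V
  app f = Inverse.to (Aut.perm f)

  VertexTransitive : Set
  VertexTransitive = ∀ x y → Σ Aut λ f → app f x ≡ y

  record InvariantEquivalence : Set₁ where
    field
      R      : V → V → Set
      isEq   : IsEquivalence R
      invar  : ∀ (f : Aut) x y → R x y → R (app f x) (app f y)

  Primitive : Set₁
  Primitive = VertexTransitive
            × (∀ (E : InvariantEquivalence) →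
                 (∀ x y → InvariantEquivalence.R E x y → x ≡ y)
               ⊎ (∀ x y → InvariantEquivalence.R E x y))

  InfiniteDiameter : Set
  InfiniteDiameter = ∀ n → ∃[ x ] ∃[ y ] ∃[ m ] (n < m × Dist x y m)

  DistinctSpheresCondition : Set
  DistinctSpheresCondition =
    ∃[ α ] (∀ γ δ → γ ≢ δ → (∃[ k ] (Dist α γ k × Dist α δ k)) →
            ∀ N → ∃[ n ] (N ≤ n × ¬ SameSphere γ δ n))

-- For fixed n, "S(γ,n) = S(δ,n)" is an automorphism-invariant equivalence
-- relation, so by primitivity it is either equality or universal. It cannot be universal
-- for n ≥ 1: infinite diameter gives a geodesic of length > n, whose initial segment
-- yields x, w with d(x,w) = n, so w ∈ S(x,n) = S(w,n), i.e. d(w,w) = n ≠ 0.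
module Submission where

open import Defs
open import Data.Nat using (ℕ; zero; suc; _+_; _∸_; _≤_; _<_; s≤s; z≤n)
open import Data.Nat.Properties using (m+[n∸m]≡n; +-monoˡ-<; <⇒≤; n≤1+n)
open import Data.Product using (Σ; ∃-syntax; _×_; _,_)
open import Data.Sum using (inj₁; inj₂)
open import Relation.Nullary using (¬_)
open import Relation.Binary.PropositionalEquality
  using (_≡_; _≢_; refl; sym; subst; subst₂)
open import Relation.Binary.Structures using (IsEquivalence)
open import Function.Bundles using (Inverse; _⇔_; mk⇔; Equivalence)
open import Function.Properties.Equivalence using (⇔-isEquivalence)
open import Function.Properties.Inverse using (↔-sym)

private
  module ⇔ {ℓ} = IsEquivalence (⇔-isEquivalence {ℓ})

module _ (Γ : Graph) where
  open Graph Γ using (V; Adj)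

  infixr 5 _++ʷ_
  _++ʷ_ : ∀ {x y z m n} → Walk Γ x y m → Walk Γ y z n → Walk Γ x z (m + n)
  here     ++ʷ q = q
  step a p ++ʷ q = step a (p ++ʷ q)

  splitWalk : ∀ {x y} m n → Walk Γ x y (m + n) → Σ V λ w → Walk Γ x w m × Walk Γ w y n
  splitWalk zero    n p          = _ , here , p
  splitWalk (suc m) n (step a p) with splitWalk m n p
  ... | w , p₁ , p₂ = w , step a p₁ , p₂

  dist-prefix : ∀ {x y m} n → n ≤ m → Dist Γ x y m → Σ V λ w → Dist Γ x w n
  dist-prefix {x} {y} {m} n n≤m (p , minimal)
    with splitWalk n (m ∸ n) (subst (Walk Γ x y) (sym (m+[n∸m]≡n n≤m)) p)
  ... | w , p₁ , p₂ = w , p₁ , λ k k<n q →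
    minimal (k + (m ∸ n))
            (subst (k + (m ∸ n) <_) (m+[n∸m]≡n n≤m) (+-monoˡ-< (m ∸ n) k<n))
            (q ++ʷ p₂)

  dist-self : ∀ {w n} → Dist Γ w w n → n ≡ 0
  dist-self {n = zero}  _           = refl
  dist-self {n = suc n} (_ , minimal) with minimal zero (s≤s z≤n) here
  ... | ()

  aut⁻¹ : Aut Γ → Aut Γ
  aut⁻¹ f = record
    { perm = ↔-sym (Aut.perm f)
    ; pres = λ x y → ⇔.sym (subst₂ (λ u v → Adj (from x) (from y) ⇔ Adj u v)
                                   (inverseˡ x) (inverseˡ y)
                                   (Aut.pres f (from x) (from y)))
    }
    where
    from : V → V
    from = Inverse.from (Aut.perm f)
    inverseˡ : ∀ x → app Γ f (from x) ≡ x
    inverseˡ = Inverse.strictlyInverseˡ (Aut.perm f)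

  app-aut⁻¹ : ∀ f x → app Γ (aut⁻¹ f) (app Γ f x) ≡ x
  app-aut⁻¹ f = Inverse.strictlyInverseʳ (Aut.perm f)

  app-aut⁻¹ʳ : ∀ f x → app Γ f (app Γ (aut⁻¹ f) x) ≡ x
  app-aut⁻¹ʳ f = Inverse.strictlyInverseˡ (Aut.perm f)

  walk-map : ∀ f {x y m} → Walk Γ x y m → Walk Γ (app Γ f x) (app Γ f y) m
  walk-map f here       = here
  walk-map f (step a p) = step (Equivalence.to (Aut.pres f _ _) a) (walk-map f p)

  walk-reflect : ∀ f {x y m} → Walk Γ (app Γ f x) (app Γ f y) m → Walk Γ x y m
  walk-reflect f {x} {y} {m} p =
    subst₂ (λ u v → Walk Γ u v m) (app-aut⁻¹ f x) (app-aut⁻¹ f y) (walk-map (aut⁻¹ f) p)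

  dist-map : ∀ f {x y n} → Dist Γ x y n → Dist Γ (app Γ f x) (app Γ f y) n
  dist-map f (p , minimal) = walk-map f p , λ k k<n q → minimal k k<n (walk-reflect f q)

  -- Every β is f (f⁻¹ β), so a sphere about f γ is the f-image of the sphere about γ.
  sameSphere-map : ∀ f {γ δ n} → SameSphere Γ γ δ n →
                   SameSphere Γ (app Γ f γ) (app Γ f δ) n
  sameSphere-map f {n = n} same β = mk⇔ (move same) (move (λ β' → ⇔.sym (same β')))
    where
    move : ∀ {x y} → SameSphere Γ x y n → Dist Γ (app Γ f x) β n → Dist Γ (app Γ f y) β n
    move {x} {y} s d =
      subst (λ z → Dist Γ (app Γ f y) z n) (app-aut⁻¹ʳ f β) (dist-map f (Equivalence.to (s β') d'))
      where
      β' : V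
      β' = app Γ (aut⁻¹ f) β
      d' : Dist Γ x β' n
      d' = subst (λ u → Dist Γ u β' n) (app-aut⁻¹ f x) (dist-map (aut⁻¹ f) d)

  sameSphereRelation : ℕ → InvariantEquivalence Γ
  sameSphereRelation n = record
    { R     = λ γ δ → SameSphere Γ γ δ n
    ; isEq  = record
      { refl  = λ β → ⇔.refl
      ; sym   = λ s β → ⇔.sym (s β)
      ; trans = λ s t β → ⇔.trans (s β) (t β)
      }
    ; invar = λ f γ δ → sameSphere-map f
    }

  sphere-inhabited : InfiniteDiameter Γ → ∀ n → ∃[ x ] ∃[ w ] Dist Γ x w n
  sphere-inhabited diam n with diam n
  ... | x , _ , _ , n<m , d with dist-prefix n (<⇒≤ n<m) d
  ... | w , dxw = x , w , dxw

  sameSphere-not-universal : InfiniteDiameter Γ → ∀ n → 1 ≤ n →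
                             ¬ (∀ γ δ → SameSphere Γ γ δ n)
  sameSphere-not-universal diam (suc n) _ universal
    with sphere-inhabited diam (suc n)
  ... | x , w , dxw with dist-self (Equivalence.to (universal x w w) dxw)
  ... | ()

  spheres-distinct : Primitive Γ → InfiniteDiameter Γ →
                     ∀ γ δ → γ ≢ δ → ∀ n → 1 ≤ n → ¬ SameSphere Γ γ δ n
  spheres-distinct (_ , prim) diam γ δ γ≢δ n 1≤n same
    with prim (sameSphereRelation n)
  ... | inj₁ trivial   = γ≢δ (trivial γ δ same)
  ... | inj₂ universal = sameSphere-not-universal diam n 1≤n universal

lemma7 : (Γ : Graph) → Connected Γ → Primitive Γ → InfiniteDiameter Γ →
         (∀ (γ δ : Graph.V Γ) → γ ≢ δ → ∀ (n : ℕ) → 1 ≤ n → ¬ SameSphere Γ γ δ n)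
         × DistinctSpheresCondition Γ
lemma7 Γ _ prim diam = distinct , distinctSpheresCondition
  where
  distinct : ∀ γ δ → γ ≢ δ → ∀ n → 1 ≤ n → ¬ SameSphere Γ γ δ n
  distinct = spheres-distinct Γ prim diam
  distinctSpheresCondition : DistinctSpheresCondition Γ
  -- Any vertex serves as α; infinite diameter is used only to obtain one.
  distinctSpheresCondition with diam 0
  ... | α , _ = α , λ γ δ γ≢δ _ N → suc N , n≤1+n N , distinct γ δ γ≢δ (suc N) (s≤s z≤n)
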